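{- Let $X,Y$ be bipartite graphs with vertex set $[n]$, let $\sigma:V(X)\to V(Y)$ be a bijection, let $u_0,v_0\in V(Y)$, and let $\tilde X$ be the graph $X$ with the edge $\sigma^{ -1}(u_0)\sigma^{ -1}(v_0)$ added. Let $G,H$ be bipartite graphs on the vertex set $[m]\cup\{u,v\}$ such that $u$ and $v$ are $(G,H)$-exchangeable from the identity arrangement $\mathrm{Id}:V(G)\to V(H)$. Suppose there exist embeddings $\psi_G:V(G)\to V(\tilde X)$ and $\psi_H:V(H)\to V(Y)$ with $\sigma\circ\psi_G=\psi_H\circ\mathrm{Id}$, $\psi_H(u)=u_0$ and $\psi_H(v)=v_0$. Then $u_0$ and $v_0$ are $(\tilde X,Y)$-exchangeable from $\sigma$.
   Context: An embedding of a graph $G$ into a graph $X$ is an injective map $V(G)\to V(X)$ sending edges to edges. For graphs $X,Y$ on the same number of vertices and a bijection $\sigma:V(X)\to V(Y)$, an $(X,Y)$-friendly swap replaces $\sigma$ by $\sigma\circ(a\ b)$ where $ab\in E(X)$ and $\sigma(a)\sigma(b)\in E(Y)$. Vertices $u,v\in V(Y)$ are $(X,Y)$-exchangeable from $\sigma$ if some sequence of $(X,Y)$-friendly swaps transforms $\sigma$ into $(u\ v)\circ\sigma$. -}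

module Defs where

open import Data.Nat using (ℕ; suc)
open import Data.Fin using (Fin; _≟_)
open import Data.Bool using (Bool)
open import Data.Sum using (_⊎_)
open import Data.Product using (_×_; Σ; ∃)
open import Relation.Nullary using (¬_; yes; no)
open import Relation.Binary.PropositionalEquality using (_≡_; _≢_)
open import Function using (_∘_; id)
open import Function.Definitions using (Injective)
open import Data.Fin.Permutation using (Permutation′; _⟨$⟩ʳ_; _⟨$⟩ˡ_)

-- A (simple, undirected) graph on vertex set Fin n = [n], given by a
-- symmetric adjacency relation. (Loops are excluded by bipartiteness
-- wherever it matters.)
record Graph (n : ℕ) : Set₁ where
  field
    Adj : Fin n → Fin n → Set
    sym : ∀ {a b} → Adj a b → Adj b a
open Graph public

Bipartite : ∀ {n} → Graph n → Set
Bipartite {n} X = Σ (Fin n → Bool) λ c → ∀ {a b} → Adj X a b → c a ≢ c b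

addEdge : ∀ {n} → Graph n → Fin n → Fin n → Graph n
addEdge X a b = record
  { Adj = λ x y → Adj X x y ⊎ ((x ≡ a × y ≡ b) ⊎ (x ≡ b × y ≡ a))
  ; sym = λ { (_⊎_.inj₁ e) → _⊎_.inj₁ (Graph.sym X e)
            ; (_⊎_.inj₂ (_⊎_.inj₁ (p , q))) → _⊎_.inj₂ (_⊎_.inj₂ (q , p))
            ; (_⊎_.inj₂ (_⊎_.inj₂ (p , q))) → _⊎_.inj₂ (_⊎_.inj₁ (q , p)) }
  }
  where open import Data.Product using (_,_)

transp : ∀ {n} → Fin n → Fin n → Fin n → Fin n
transp a b x with x ≟ a
... | yes _ = b
... | no _ with x ≟ b
...   | yes _ = a
...   | no _ = x

_≗_ : ∀ {n} → (Fin n → Fin n) → (Fin n → Fin n) → Set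
f ≗ g = ∀ x → f x ≡ g x

data Reach {n : ℕ} (X Y : Graph n) : (Fin n → Fin n) → (Fin n → Fin n) → Set where
  done : ∀ {σ τ} → σ ≗ τ → Reach X Y σ τ
  swap : ∀ {σ τ} (a b : Fin n) → Adj X a b → Adj Y (σ a) (σ b) →
         Reach X Y (σ ∘ transp a b) τ → Reach X Y σ τ

Exchangeable : ∀ {n} → Graph n → Graph n → (Fin n → Fin n) → Fin n → Fin n → Set
Exchangeable X Y σ u v = Reach X Y σ (transp u v ∘ σ)

IsEmbedding : ∀ {k n} → Graph k → Graph n → (Fin k → Fin n) → Set
IsEmbedding G X ψ = Injective _≡_ _≡_ ψ × (∀ {a b} → Adj G a b → Adj X (ψ a) (ψ b))

{-# OPTIONS --safe #-}
module Submission where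

-- Every friendly swap of the (G,H) sequence exchanging u and v is carried by
-- the embeddings to a friendly swap of the (X̃,Y) sequence, along the image
-- edge ψG a ψG b, while vertices of X̃ outside the image of ψG never move.
-- Since σ ∘ ψG = ψH and ψH sends u, v to u₀, v₀, the image sequence turns σ
-- into (u₀ v₀) ∘ σ.

open import Defs hiding (sym)
open import Data.Nat using (ℕ; suc)
open import Data.Fin using (Fin; _≟_)
open import Data.Fin.Properties using (any?)
open import Data.Fin.Permutation using (Permutation′; _⟨$⟩ʳ_; _⟨$⟩ˡ_)
open import Data.Product using (_,_)
open import Data.Empty using (⊥-elim)
open import Relation.Nullary using (yes; no)
open import Relation.Binary.PropositionalEquality
  using (_≡_; _≢_; refl; sym; trans; cong; subst₂; module ≡-Reasoning)
open import Function using (_∘_; id)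
open import Function.Bundles using (Injection)
open import Function.Definitions using (Injective)
open import Function.Properties.Inverse using (↔⇒↣)

transp-fixes : ∀ {n} (a b z : Fin n) → z ≢ a → z ≢ b → transp a b z ≡ z
transp-fixes a b z z≢a z≢b with z ≟ a
... | yes z≡a = ⊥-elim (z≢a z≡a)
... | no _ with z ≟ b
...   | yes z≡b = ⊥-elim (z≢b z≡b)
...   | no _ = refl

injective⇒transp-natural : ∀ {k n} (f : Fin k → Fin n) → Injective _≡_ _≡_ f →
  ∀ a b x → f (transp a b x) ≡ transp (f a) (f b) (f x)
injective⇒transp-natural f f-inj a b x with x ≟ a | f x ≟ f a
... | yes _   | yes _    = refl
... | yes x≡a | no fx≢fa = ⊥-elim (fx≢fa (cong f x≡a))
... | no x≢a  | yes fx≡fa = ⊥-elim (x≢a (f-inj fx≡fa))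
... | no _    | no _ with x ≟ b | f x ≟ f b
...   | yes _   | yes _    = refl
...   | yes x≡b | no fx≢fb = ⊥-elim (fx≢fb (cong f x≡b))
...   | no x≢b  | yes fx≡fb = ⊥-elim (x≢b (f-inj fx≡fb))
...   | no _    | no _     = refl

OutsideImage : ∀ {k n} → (Fin k → Fin n) → Fin n → Set
OutsideImage ψ z = ∀ x → z ≢ ψ x

module _ {k n : ℕ} (ψG ψH : Fin k → Fin n) where

  Tracks : (Fin k → Fin k) → (Fin n → Fin n) → Set
  Tracks τ ρ = ∀ x → ρ (ψG x) ≡ ψH (τ x)

  Tracks-transp : Injective _≡_ _≡_ ψH → ∀ τ ρ a b → Tracks τ ρ →
    Tracks (transp a b ∘ τ) (transp (ψH a) (ψH b) ∘ ρ)
  Tracks-transp ψH-inj τ ρ a b ρ~τ x = begin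
    transp (ψH a) (ψH b) (ρ (ψG x))      ≡⟨ cong (transp (ψH a) (ψH b)) (ρ~τ x) ⟩
    transp (ψH a) (ψH b) (ψH (τ x))      ≡⟨ injective⇒transp-natural ψH ψH-inj a b (τ x) ⟨
    ψH (transp a b (τ x))                ∎
    where open ≡-Reasoning

module _ {k n} {G H : Graph k} {X Y : Graph n} {ψG ψH : Fin k → Fin n}
  (ψG-inj : Injective _≡_ _≡_ ψG)
  (ψG-hom : ∀ {a b} → Adj G a b → Adj X (ψG a) (ψG b))
  (ψH-hom : ∀ {a b} → Adj H a b → Adj Y (ψH a) (ψH b)) where

  Reach-lift : ∀ {τ τ′ ρ ρ′} → Reach G H τ τ′ →
    Tracks ψG ψH τ ρ → Tracks ψG ψH τ′ ρ′ →
    (∀ z → OutsideImage ψG z → ρ′ z ≡ ρ z) → Reach X Y ρ ρ′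
  Reach-lift {ρ = ρ} {ρ′} (done τ≗τ′) ρ~τ ρ′~τ′ fixed = done ρ≗ρ′
    where
    ρ≗ρ′ : ρ ≗ ρ′
    ρ≗ρ′ z with any? (λ x → z ≟ ψG x)
    ... | yes (x , refl) = trans (ρ~τ x) (trans (cong ψH (τ≗τ′ x)) (sym (ρ′~τ′ x)))
    ... | no z∉im = sym (fixed z (λ x z≡ψGx → z∉im (x , z≡ψGx)))
  Reach-lift {τ} {ρ = ρ} {ρ′} (swap a b ab∈G τab∈H rest) ρ~τ ρ′~τ′ fixed =
    swap (ψG a) (ψG b) (ψG-hom ab∈G)
      (subst₂ (Adj Y) (sym (ρ~τ a)) (sym (ρ~τ b)) (ψH-hom τab∈H))
      (Reach-lift rest ρ~τ∘ab ρ′~τ′ fixed′)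
    where
    ρ~τ∘ab : Tracks ψG ψH (τ ∘ transp a b) (ρ ∘ transp (ψG a) (ψG b))
    ρ~τ∘ab x = trans (cong ρ (sym (injective⇒transp-natural ψG ψG-inj a b x)))
                     (ρ~τ (transp a b x))
    fixed′ : ∀ z → OutsideImage ψG z → ρ′ z ≡ ρ (transp (ψG a) (ψG b) z)
    fixed′ z z∉im rewrite transp-fixes (ψG a) (ψG b) z (z∉im a) (z∉im b) = fixed z z∉im

proposition3p2 : (n m : ℕ) (X Y : Graph n) → Bipartite X → Bipartite Y →
    (σ : Permutation′ n) (u₀ v₀ : Fin n) →
    (G H : Graph (suc (suc m))) → Bipartite G → Bipartite H →
    (u v : Fin (suc (suc m))) → u ≢ v →
    Exchangeable G H id u v →
    (ψG ψH : Fin (suc (suc m)) → Fin n) →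
    IsEmbedding G (addEdge X (σ ⟨$⟩ˡ u₀) (σ ⟨$⟩ˡ v₀)) ψG →
    IsEmbedding H Y ψH →
    (∀ x → σ ⟨$⟩ʳ ψG x ≡ ψH (id x)) →
    ψH u ≡ u₀ → ψH v ≡ v₀ →
    Exchangeable (addEdge X (σ ⟨$⟩ˡ u₀) (σ ⟨$⟩ˡ v₀)) Y (σ ⟨$⟩ʳ_) u₀ v₀
proposition3p2 _ _ _ _ _ _ σ _ _ _ _ _ _ u v _ u⇄v ψG ψH
  (ψG-inj , ψG-hom) (ψH-inj , ψH-hom) σ∘ψG≗ψH refl refl =
  Reach-lift ψG-inj ψG-hom ψH-hom u⇄v σ∘ψG≗ψH
    (Tracks-transp ψG ψH ψH-inj id (σ ⟨$⟩ʳ_) u v σ∘ψG≗ψH) fixed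
  where
  σ-inj : Injective _≡_ _≡_ (σ ⟨$⟩ʳ_)
  σ-inj = Injection.injective (↔⇒↣ σ)

  σ≢ψH : ∀ {z} → OutsideImage ψG z → ∀ x → σ ⟨$⟩ʳ z ≢ ψH x
  σ≢ψH z∉im x σz≡ψHx = z∉im x (σ-inj (trans σz≡ψHx (sym (σ∘ψG≗ψH x))))

  fixed : ∀ z → OutsideImage ψG z → transp (ψH u) (ψH v) (σ ⟨$⟩ʳ z) ≡ σ ⟨$⟩ʳ z
  fixed z z∉im = transp-fixes (ψH u) (ψH v) (σ ⟨$⟩ʳ z) (σ≢ψH z∉im u) (σ≢ψH z∉im v)
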